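{- Let $A$ be a multigraph of con-edges satisfying Property 1, such that $A[\alpha]$ is connected for every cluster $\alpha$, no con-edge for any cluster $\alpha$ is a bridge of $A[\alpha]$, $K_A$ is bipartite, and no con-edge of $A$ is a self-loop. Let $e$ be a con-edge of $A$ that conflicts with no other con-edge of $A$. Then there exists a planar set of spanning trees for $A$ if and only if there exists a planar set $S'$ of spanning trees for $A$ with $e\in S'$.
   Context: Setting: $C(G,T)$ is an embedded flat clustered graph: a planar graph $G$ with a fixed planar embedding whose vertex set is partitioned into clusters; $G[\alpha]$ is the subgraph induced by cluster $\alpha$. For a face $f$ of $G$, a con-edge in $f$ is a pair of occurrences, on the boundary walk of $f$, of two distinct vertices of the same cluster $\alpha$ lying in different connected components of $G[\alpha]$; it is a con-edge for $\alpha$, drawn inside $f$. Two con-edges conflict (cross) iff they lie in the same face and their occurrences alternate along its boundary; they are drawn so that they cross iff they conflict. The multigraph of con-edges is obtained by inserting all con-edges, contracting each connected component of each $G[\alpha]$ into one vertex (belonging to $\alpha$), and deleting the edges of $G$. Throughout, "a multigraph of con-edges $A$" means this multigraph or one obtained from it by a sequence of removals of con-edges and contractions (identification of the two end-vertices, possibly creating self-loops) of con-edges that cross no other con-edge; conflicts among the remaining con-edges are unchanged. $A[\alpha]$ is the sub-multigraph formed by the vertices of $\alpha$ and the con-edges for $\alpha$. A planar set of spanning trees for $A$ is a set $S$ of con-edges such that, for each cluster $\alpha$, the con-edges for $\alpha$ in $S$ form a tree spanning all vertices of $A$ in $\alpha$, and no two con-edges of $S$ conflict. The conflict graph $K_A$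 has a vertex per con-edge and an edge for each conflicting pair. Property 1: no two distinct con-edges for the same cluster lie in the same connected component of $K_A$. -}

module Defs where

open import Data.Nat using (ℕ; _<_)
open import Data.Fin using (Fin)
open import Data.Fin.Subset using (Subset; _∈_; _∉_)
open import Data.Product using (Σ; _×_; ∃)
open import Data.Sum using (_⊎_)
open import Data.Bool using (Bool)
open import Relation.Nullary using (¬_)
open import Relation.Binary.PropositionalEquality using (_≡_; _≢_)
open import Relation.Binary.Construct.Closure.ReflexiveTransitive using (Star)

-- Each con-edge e is a con-edge for cluster (ecl e), joins src e and tgt e
-- (both in that cluster), and is drawn in face (face e) between the two
-- boundary-walk occurrences occ₁ e < occ₂ e (positions along the boundary
-- walk of that face, read from a fixed starting point).
record ConMultigraph : Set where
  field
    nV nE nC : ℕ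
    cl       : Fin nV → Fin nC
    src tgt  : Fin nE → Fin nV
    ecl      : Fin nE → Fin nC
    src-cl   : ∀ e → cl (src e) ≡ ecl e
    tgt-cl   : ∀ e → cl (tgt e) ≡ ecl e
    face     : Fin nE → ℕ
    occ₁ occ₂ : Fin nE → ℕ
    occ<     : ∀ e → occ₁ e < occ₂ e

module _ (A : ConMultigraph) where
  open ConMultigraph A

  Conflict : Fin nE → Fin nE → Set
  Conflict e f = face e ≡ face f ×
    ((occ₁ e < occ₁ f × occ₁ f < occ₂ e × occ₂ e < occ₂ f)
     ⊎ (occ₁ f < occ₁ e × occ₁ e < occ₂ f × occ₂ f < occ₂ e))

  Step : (Fin nE → Set) → Fin nV → Fin nV → Set
  Step P x y = Σ (Fin nE) λ e → P e ×
    ((src e ≡ x × tgt e ≡ y) ⊎ (src e ≡ y × tgt e ≡ x))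

  Reach : (Fin nE → Set) → Fin nV → Fin nV → Set
  Reach P = Star (Step P)

  InCl : Fin nC → Fin nE → Set
  InCl α e = ecl e ≡ α

  ClusterConnected : Fin nC → Set
  ClusterConnected α = ∀ u v → cl u ≡ α → cl v ≡ α → Reach (InCl α) u v

  IsBridge : Fin nE → Set
  IsBridge e = ¬ Reach (λ f → InCl (ecl e) f × f ≢ e) (src e) (tgt e)

  KBipartite : Set
  KBipartite = Σ (Fin nE → Bool) λ c → ∀ e f → Conflict e f → c e ≢ c f

  -- Property 1: no two distinct con-edges for the same cluster are in the
  -- same connected component of K_A
  Property1 : Set
  Property1 = ∀ e f → e ≢ f → ecl e ≡ ecl f → ¬ Star Conflict e f

  NoSelfLoop : Set
  NoSelfLoop = ∀ e → src e ≢ tgt e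

  InSα : Subset nE → Fin nC → Fin nE → Set
  InSα S α f = f ∈ S × InCl α f

  -- the con-edges for α in S form a tree spanning all vertices of α:
  -- connected on the vertices of α, and acyclic (every edge is a bridge;
  -- in particular no self-loops)
  SpanningTreeFor : Subset nE → Fin nC → Set
  SpanningTreeFor S α =
    (∀ u v → cl u ≡ α → cl v ≡ α → Reach (InSα S α) u v) ×
    (∀ e → InSα S α e →
       ¬ Reach (λ f → InSα S α f × f ≢ e) (src e) (tgt e))

  PlanarSetOfSpanningTrees : Subset nE → Set
  PlanarSetOfSpanningTrees S =
    (∀ α → SpanningTreeFor S α) ×
    (∀ e f → e ∈ S → f ∈ S → ¬ Conflict e f)

module Submission where

-- One direction is trivial; for
-- the other we perform a tree exchange.  Let S be a planar set of spanning
-- trees and Q the tree of S for the cluster α of e.  Since e is not a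
-- self-loop, the Q-path between the ends of e contains an edge f of Q that
-- "straddles" them: one end of e reaches one end of f and the other end of f
-- reaches the other end of e, both without using f.  Replacing f by e keeps Q
-- connected (the ends of f are re-joined through e) and acyclic (a cycle
-- would reconnect the ends of e in Q − f, making Q cyclic), while the trees
-- of the other clusters are untouched; planarity is kept because e conflicts
-- with nothing.
--
-- The theorem follows by applying the exchange to the
-- tree of e's cluster.

open import Defs
open import Data.Fin using (Fin; _≟_)
open import Data.Fin.Subset using (Subset; _∈_; _∩_; _∪_; ∁; ⁅_⁆)
open import Data.Fin.Subset.Properties
  using (x∈⁅x⁆; x∈⁅y⁆⇒x≡y; x≢y⇒x∉⁅y⁆; x∉p⇒x∈∁p; x∈∁p⇒x∉p;
         x∈p∩q⁺; x∈p∩q⁻; x∈p∪q⁻; p⊆p∪q; q⊆p∪q)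
open import Data.Product using (Σ; _×_; _,_; proj₁; proj₂)
open import Data.Sum using (_⊎_; inj₁; inj₂)
import Data.Sum as Sum
open import Data.Nat using (ℕ; suc; _≤_; z≤n; s≤s)
open import Data.Nat.Properties using (≤-refl; ≤-trans; m≤n⇒m≤1+n)
open import Data.Empty using (⊥-elim)
open import Function.Bundles using (_⇔_; mk⇔)
open import Relation.Nullary using (¬_; yes; no)
open import Relation.Unary using (_⊆′_)
open import Relation.Binary.PropositionalEquality using (_≡_; _≢_; refl; sym; trans)
open import Relation.Binary.Construct.Closure.ReflexiveTransitive using (ε; _◅_; _◅◅_)
import Relation.Binary.Construct.Closure.ReflexiveTransitive as Closure

replace : ∀ {n} → Subset n → Fin n → Fin n → Subset n
replace S f e = (S ∩ ∁ ⁅ f ⁆) ∪ ⁅ e ⁆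

∈-replace-new : ∀ {n} (S : Subset n) f e → e ∈ replace S f e
∈-replace-new S f e = q⊆p∪q (S ∩ ∁ ⁅ f ⁆) ⁅ e ⁆ (x∈⁅x⁆ e)

∈-replace-old : ∀ {n} {S : Subset n} {f e g} → g ∈ S → g ≢ f → g ∈ replace S f e
∈-replace-old g∈S g≢f = p⊆p∪q _ (x∈p∩q⁺ (g∈S , x∉p⇒x∈∁p (x≢y⇒x∉⁅y⁆ g≢f)))

∈-replace⁻ : ∀ {n} (S : Subset n) f e {g} → g ∈ replace S f e → g ≡ e ⊎ (g ∈ S × g ≢ f)
∈-replace⁻ S f e g∈ with x∈p∪q⁻ (S ∩ ∁ ⁅ f ⁆) ⁅ e ⁆ g∈
... | inj₂ g∈⁅e⁆ = inj₁ (x∈⁅y⁆⇒x≡y e g∈⁅e⁆)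
... | inj₁ g∈S∖f with x∈p∩q⁻ S (∁ ⁅ f ⁆) g∈S∖f
...   | g∈S , g∈∁f = inj₂ (g∈S , λ { refl → x∈∁p⇒x∉p g∈∁f (x∈⁅x⁆ f) })

module _ (A : ConMultigraph) where
  open ConMultigraph A

  EdgeSet : Set₁
  EdgeSet = Fin nE → Set

  Without : EdgeSet → Fin nE → EdgeSet
  Without R h g = R g × g ≢ h

  Add : Fin nE → EdgeSet → EdgeSet
  Add e R g = g ≡ e ⊎ R g

  without-mono : ∀ {R R'} h → R ⊆′ R' → Without R h ⊆′ Without R' h
  without-mono _ R⊆R' g (Rg , g≢h) = R⊆R' g Rg , g≢h

  Joins : Fin nE → Fin nV → Fin nV → Set
  Joins g a b = (src g ≡ a × tgt g ≡ b) ⊎ (src g ≡ b × tgt g ≡ a)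

  joins-ends : ∀ g → Joins g (src g) (tgt g)
  joins-ends g = inj₁ (refl , refl)

  joins-far-end : ∀ {g u w a b} → Joins g u w → Joins g a b → b ≡ w ⊎ b ≡ u
  joins-far-end (inj₁ (refl , refl)) (inj₁ (refl , refl)) = inj₁ refl
  joins-far-end (inj₁ (refl , refl)) (inj₂ (refl , refl)) = inj₂ refl
  joins-far-end (inj₂ (refl , refl)) (inj₁ (refl , refl)) = inj₂ refl
  joins-far-end (inj₂ (refl , refl)) (inj₂ (refl , refl)) = inj₁ refl

  len : ∀ {R u v} → Reach A R u v → ℕ
  len ε = 0
  len (_ ◅ r) = suc (len r)

  reach-mono : ∀ {R R' u v} → R ⊆′ R' → Reach A R u v → Reach A R' u v
  reach-mono R⊆R' = Closure.map λ (g , Rg , o) → g , R⊆R' g Rg , o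

  reach-rev : ∀ {R u v} → Reach A R u v → Reach A R v u
  reach-rev = Closure.reverse λ (g , Rg , o) → g , Rg , Sum.swap o

  edge : ∀ {R g a b} → R g → Joins g a b → Reach A R a b
  edge Rg o = (_ , Rg , o) ◅ ε

  reach-between-ends : ∀ {R g a b c d} → Joins g a b → Joins g c d →
    Reach A R a b → Reach A R c d
  reach-between-ends (inj₁ (refl , refl)) (inj₁ (refl , refl)) p = p
  reach-between-ends (inj₁ (refl , refl)) (inj₂ (refl , refl)) p = reach-rev p
  reach-between-ends (inj₂ (refl , refl)) (inj₁ (refl , refl)) p = reach-rev p
  reach-between-ends (inj₂ (refl , refl)) (inj₂ (refl , refl)) p = p

  -- How a walk from u to v in R, of length at most n, meets the edge h:
  -- either it can avoid h, or it shortcuts to a walk using h exactly once,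
  -- whose part after h is still of length at most n.
  data Split (R : EdgeSet) (h : Fin nE) (u v : Fin nV) (n : ℕ) : Set where
    avoids  : (q : Reach A (Without R h) u v) → len q ≤ n → Split R h u v n
    through : ∀ {a b} → R h → Joins h a b → Reach A (Without R h) u a →
              (q : Reach A (Without R h) b v) → len q ≤ n → Split R h u v n

  split-cons : ∀ {R h u w v n} → Step A (Without R h) u w →
    Split R h w v n → Split R h u v (suc n)
  split-cons s (avoids q le) = avoids (s ◅ q) (s≤s le)
  split-cons s (through Rh o q₁ q₂ le) = through Rh o (s ◅ q₁) q₂ (m≤n⇒m≤1+n le)

  -- a first step along h itself is the single use of h, unless the rest of
  -- the walk returns across h, in which case the walk after that return avoids h
  split-along : ∀ {R h u w v n} → R h → Joins h u w →
    Split R h w v n → Split R h u v (suc n)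
  split-along Rh o (avoids q le) = through Rh o ε q (m≤n⇒m≤1+n le)
  split-along Rh o (through _ o' _ q le) with joins-far-end o o'
  ... | inj₁ refl = through Rh o ε q (m≤n⇒m≤1+n le)
  ... | inj₂ refl = avoids q (m≤n⇒m≤1+n le)

  split : ∀ {R u v} h (p : Reach A R u v) → Split R h u v (len p)
  split h ε = avoids ε z≤n
  split h ((g , Rg , o) ◅ r) with g ≟ h
  ... | yes refl = split-along Rg o (split h r)
  ... | no g≢h = split-cons (g , (Rg , g≢h) , o) (split h r)

  Acyclic : EdgeSet → Set
  Acyclic R = ∀ g → R g → ¬ Reach A (Without R g) (src g) (tgt g)

  acyclic-antitone : ∀ {R R'} → R' ⊆′ R → Acyclic R → Acyclic R'
  acyclic-antitone R'⊆R acyclic g R'g p =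
    acyclic g (R'⊆R g R'g) (reach-mono (without-mono g R'⊆R) p)

  data Straddles (R : EdgeSet) (f : Fin nE) (x y : Fin nV) : Set where
    straddles : ∀ {a b} → Joins f a b → Reach A (Without R f) x a →
                Reach A (Without R f) b y → Straddles R f x y

  straddle-cycle : ∀ {R R' f x y} → Without R f ⊆′ R' → Straddles R f x y →
    Reach A R' x y → Reach A R' (src f) (tgt f)
  straddle-cycle incl (straddles o before after) p =
    reach-between-ends o (joins-ends _)
      (reach-rev (reach-mono incl before) ◅◅ p ◅◅ reach-rev (reach-mono incl after))

  straddle-separates : ∀ {Q f x y} → Acyclic Q → Q f → Straddles Q f x y →
    ¬ Reach A (Without Q f) x y
  straddle-separates acyclic Qf st p = acyclic _ Qf (straddle-cycle (λ _ w → w) st p)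

  -- The walk is shortened, so the induction is on a length bound n;
  -- walks in subsets R of Q are allowed since shortening removes edges.
  straddling-edge-bounded : ∀ {Q} → Acyclic Q → ∀ n {R x y} → R ⊆′ Q →
    (p : Reach A R x y) → len p ≤ n → x ≢ y → Σ (Fin nE) λ f → Q f × Straddles Q f x y
  straddling-edge-bounded _ _ _ ε _ x≢y = ⊥-elim (x≢y refl)
  straddling-edge-bounded acyclic (suc n) R⊆Q ((g , Rg , o) ◅ r) (s≤s le) x≢y
    with split g r
  ... | avoids q _ = g , R⊆Q g Rg , straddles o ε (reach-mono (without-mono g R⊆Q) q)
  ... | through _ o' q₁ q₂ le' with joins-far-end o o'
  ...   | inj₁ refl = ⊥-elim (acyclic g (R⊆Q g Rg)
                        (reach-between-ends o' (joins-ends g)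
                          (reach-rev (reach-mono (without-mono g R⊆Q) q₁))))
  ...   | inj₂ refl = straddling-edge-bounded acyclic n (λ h w → R⊆Q h (proj₁ w)) q₂
                        (≤-trans le' le) x≢y

  straddling-edge : ∀ {Q x y} → Acyclic Q → Reach A Q x y → x ≢ y →
    Σ (Fin nE) λ f → Q f × Straddles Q f x y
  straddling-edge acyclic p = straddling-edge-bounded acyclic (len p) (λ _ w → w) p ≤-refl

  cycle-with-added-edge : ∀ {R e g} → R g →
    Reach A (Without (Add e R) g) (src g) (tgt g) →
    Reach A (Without R g) (src g) (tgt g) ⊎ Reach A R (src e) (tgt e)
  cycle-with-added-edge {R} {e} {g} Rg p with split e p
  ... | avoids q _ = inj₁ (reach-mono drop-e q)
    where
    drop-e : Without (Without (Add e R) g) e ⊆′ Without R g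
    drop-e _ ((inj₁ h≡e , _) , h≢e) = ⊥-elim (h≢e h≡e)
    drop-e _ ((inj₂ Rh , h≢g) , _) = Rh , h≢g
  ... | through _ o q₁ q₂ _ =
    inj₂ (straddle-cycle to-R (straddles o q₁ q₂) (edge Rg (joins-ends g)))
    where
    to-R : Without (Without (Add e R) g) e ⊆′ R
    to-R _ ((inj₁ h≡e , _) , h≢e) = ⊥-elim (h≢e h≡e)
    to-R _ ((inj₂ Rh , _) , _) = Rh

  exchange-connects : ∀ {Q f e u v} → Straddles Q f (src e) (tgt e) →
    Reach A Q u v → Reach A (Add e (Without Q f)) u v
  exchange-connects {Q} {f} {e} st p with split f p
  ... | avoids q _ = reach-mono (λ _ → inj₂) q
  ... | through _ o q₁ q₂ _ =
    reach-mono (λ _ → inj₂) q₁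
      ◅◅ reach-between-ends (joins-ends f) o f-bypass
      ◅◅ reach-mono (λ _ → inj₂) q₂
    where
    f-bypass : Reach A (Add e (Without Q f)) (src f) (tgt f)
    f-bypass = straddle-cycle (λ _ → inj₂) st (edge (inj₁ refl) (joins-ends e))

  exchange-acyclic : ∀ {Q f e} → Acyclic Q → Q f → Straddles Q f (src e) (tgt e) →
    Acyclic (Add e (Without Q f))
  exchange-acyclic {Q} {f} {e} acyclic Qf st g (inj₁ refl) p =
    straddle-separates acyclic Qf st (reach-mono drop-e p)
    where
    drop-e : Without (Add e (Without Q f)) e ⊆′ Without Q f
    drop-e _ (inj₁ h≡e , h≢e) = ⊥-elim (h≢e h≡e)
    drop-e _ (inj₂ w , _) = w
  exchange-acyclic acyclic Qf st g (inj₂ (Qg , g≢f)) p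
    with cycle-with-added-edge (Qg , g≢f) p
  ... | inj₁ c = acyclic g Qg (reach-mono (without-mono g (λ _ → proj₁)) c)
  ... | inj₂ c = straddle-separates acyclic Qf st c

  spanning-tree-via : ∀ {S β} (T : EdgeSet) →
    (∀ u v → cl u ≡ β → cl v ≡ β → Reach A T u v) → Acyclic T →
    T ⊆′ InSα A S β → InSα A S β ⊆′ T → SpanningTreeFor A S β
  spanning-tree-via T connected acyclic T⊆ ⊆T =
    (λ u v cu cv → reach-mono T⊆ (connected u v cu cv)) , acyclic-antitone ⊆T acyclic

  conflict-sym : ∀ {g h} → Conflict A g h → Conflict A h g
  conflict-sym (same-face , inj₁ alt) = sym same-face , inj₂ alt
  conflict-sym (same-face , inj₂ alt) = sym same-face , inj₁ alt

  module Replacement (S : Subset nE) (f e : Fin nE) (same-cluster : ecl f ≡ ecl e) where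
    S' : Subset nE
    S' = replace S f e

    tree-own-cluster : SpanningTreeFor A S (ecl e) → InSα A S (ecl e) f →
      Straddles (InSα A S (ecl e)) f (src e) (tgt e) → SpanningTreeFor A S' (ecl e)
    tree-own-cluster (connected , acyclic) Qf st =
      spanning-tree-via T (λ u v cu cv → exchange-connects st (connected u v cu cv))
        (exchange-acyclic acyclic Qf st) T⊆ ⊆T
      where
      T : EdgeSet
      T = Add e (Without (InSα A S (ecl e)) f)
      T⊆ : T ⊆′ InSα A S' (ecl e)
      T⊆ _ (inj₁ refl) = ∈-replace-new S f e , refl
      T⊆ _ (inj₂ ((g∈S , gβ) , g≢f)) = ∈-replace-old g∈S g≢f , gβ
      ⊆T : InSα A S' (ecl e) ⊆′ T
      ⊆T g (g∈S' , gβ) with ∈-replace⁻ S f e g∈S'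
      ... | inj₁ g≡e = inj₁ g≡e
      ... | inj₂ (g∈S , g≢f) = inj₂ ((g∈S , gβ) , g≢f)

    tree-other-cluster : ∀ {β} → ecl e ≢ β → SpanningTreeFor A S β →
      SpanningTreeFor A S' β
    tree-other-cluster {β} e∉β (connected , acyclic) =
      spanning-tree-via (InSα A S β) connected acyclic S⊆ ⊆S
      where
      S⊆ : InSα A S β ⊆′ InSα A S' β
      S⊆ _ (g∈S , gβ) = ∈-replace-old g∈S (λ { refl → e∉β (trans (sym same-cluster) gβ) }) , gβ
      ⊆S : InSα A S' β ⊆′ InSα A S β
      ⊆S g (g∈S' , gβ) with ∈-replace⁻ S f e g∈S'
      ... | inj₁ refl = ⊥-elim (e∉β gβ)
      ... | inj₂ (g∈S , _) = g∈S , gβ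

    -- e conflicts with nothing and the rest of S' lies in S
    planar : (∀ h → ¬ Conflict A e h) → (∀ g h → g ∈ S → h ∈ S → ¬ Conflict A g h) →
      ∀ g h → g ∈ S' → h ∈ S' → ¬ Conflict A g h
    planar e-free S-planar g h g∈S' h∈S' c
      with ∈-replace⁻ S f e g∈S' | ∈-replace⁻ S f e h∈S'
    ... | inj₁ refl | _ = e-free h c
    ... | inj₂ _ | inj₁ refl = e-free g (conflict-sym c)
    ... | inj₂ (g∈S , _) | inj₂ (h∈S , _) = S-planar g h g∈S h∈S c

  force-conflict-free-edge : NoSelfLoop A → (e : Fin nE) → (∀ h → ¬ Conflict A e h) →
    (S : Subset nE) → PlanarSetOfSpanningTrees A S →
    Σ (Subset nE) λ S' → PlanarSetOfSpanningTrees A S' × e ∈ S'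
  force-conflict-free-edge no-loop e e-free S (trees , S-planar)
    with straddling-edge (proj₂ (trees (ecl e)))
           (proj₁ (trees (ecl e)) (src e) (tgt e) (src-cl e) (tgt-cl e)) (no-loop e)
  ... | f , Qf , st = S' , (tree , planar e-free S-planar) , ∈-replace-new S f e
    where
    open Replacement S f e (proj₂ Qf)
    tree : ∀ β → SpanningTreeFor A S' β
    tree β with ecl e ≟ β
    ... | yes refl = tree-own-cluster (trees (ecl e)) Qf st
    ... | no e∉β = tree-other-cluster e∉β (trees β)

lemma8 : (A : ConMultigraph) →
    Property1 A →
    (∀ α → ClusterConnected A α) →
    (∀ e → ¬ IsBridge A e) →
    KBipartite A →
    NoSelfLoop A →
    (e : Fin (ConMultigraph.nE A)) →
    (∀ f → ¬ Conflict A e f) →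
    (Σ (Subset (ConMultigraph.nE A)) (PlanarSetOfSpanningTrees A))
    ⇔ (Σ (Subset (ConMultigraph.nE A)) λ S → PlanarSetOfSpanningTrees A S × e ∈ S)
lemma8 A _ _ _ _ no-loop e e-free =
  mk⇔ (λ (S , planar) → force-conflict-free-edge A no-loop e e-free S planar)
      (λ (S , planar , _) → S , planar)
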